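{- Let $m\ge2$, let $X$ and $f$ be the two-digit base-$m$ Kaprekar system, and let $r\ge0$ be the integer with $2^r\mid m+1$ and $2^{r+1}\nmid m+1$. For an integer $a$ with $1\le a\le m$, the element $a(m-1)\in X$ belongs to some non-trivial fixed set $K(x)$ ($x\in X$, $K(x)\neq\{0\}$) if and only if $2^r\mid a$ and $2^{r+1}\nmid a$. Equivalently, the union of all non-trivial fixed sets is $\{a(m-1): 1\le a\le m,\ 2^r\mid a,\ 2^{r+1}\nmid a\}$.
   Context: $X=\{0,1,\dots,m^2-1\}$, each element written with exactly two base-$m$ digits $x=d_1m+d_0$ (leading zeros allowed). The map is $f(x)=\big(m\max(d_0,d_1)+\min(d_0,d_1)\big)-\big(m\min(d_0,d_1)+\max(d_0,d_1)\big)=(m-1)|d_1-d_0|$. Iterates: $f^0=\mathrm{id}$ and $f^t=f\circ f^{t-1}$. For $x\in X$: $S(x)$ is the least $s\ge0$ such that $f^{s+t}(x)=f^s(x)$ for some $t\ge1$. $T(x)$ is the least $t\ge1$ with $f^{S(x)+t}(x)=f^{S(x)}(x)$. The fixed set is $K(x)=\{f^{S(x)+i}(x):0\le i<T(x)\}$. Every element of a fixed set lies in $f(X)$, hence is a multiple of $m-1$. -}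

module Defs where

open import Data.Nat using (ℕ; zero; suc; _+_; _*_; _∸_; _<_; _≤_; NonZero)
import Data.Nat
open import Data.Nat.DivMod using (_/_; _%_)

open import Data.Product using (Σ; ∃; _×_; _,_)
open import Relation.Binary.PropositionalEquality using (_≡_; _≢_)
open import Relation.Nullary using (¬_)

-- Two-digit base-m Kaprekar map on X = {0,…,m²-1}, with x = d₁ m + d₀,
-- d₁ = x / m, d₀ = x % m.  f(x) = (m·max + min) − (m·min + max) = (m−1)|d₁ − d₀|.
module Kaprekar (m : ℕ) .{{_ : NonZero m}} where

  d₁ : ℕ → ℕ
  d₁ x = x / m

  d₀ : ℕ → ℕ
  d₀ x = x % m

  f : ℕ → ℕ
  f x = (m * (d₀ x Data.Nat.⊔ d₁ x) + (d₀ x Data.Nat.⊓ d₁ x))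
        ∸ (m * (d₀ x Data.Nat.⊓ d₁ x) + (d₀ x Data.Nat.⊔ d₁ x))

  iter : ℕ → ℕ → ℕ
  iter zero    x = x
  iter (suc t) x = f (iter t x)

  InX : ℕ → Set
  InX x = x < m * m

  Recurs : ℕ → ℕ → Set
  Recurs x s = Σ ℕ λ t → (1 ≤ t) × (iter (s + t) x ≡ iter s x)

  IsS : ℕ → ℕ → Set
  IsS x s = Recurs x s × (∀ s' → s' < s → ¬ Recurs x s')

  IsT : ℕ → ℕ → ℕ → Set
  IsT x s t = (1 ≤ t) × (iter (s + t) x ≡ iter s x)
            × (∀ t' → 1 ≤ t' → t' < t → iter (s + t') x ≢ iter s x)

  InK : ℕ → ℕ → Set
  InK x y = Σ ℕ λ s → Σ ℕ λ t → IsS x s × IsT x s t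
            × (Σ ℕ λ i → (i < t) × (y ≡ iter (s + i) x))

  -- K(x) ≠ {0}  (K(x) is nonempty, so this means K(x) has a nonzero element)
  NonTrivialK : ℕ → Set
  NonTrivialK x = Σ ℕ λ z → InK x z × (z ≢ 0)

-- Write m = n + 1 and N = m + 1. The base-m digits of b·n (1 ≤ b ≤ m) are b − 1 and m − b, so
-- f(b·n) = g(b)·n with g(b) = |N − 2b|: the multiples of n are closed under f and f acts on them
-- as g acts on multipliers. Since g(b) = ±(N − 2b), a power of 2 dividing both 2b and N divides g(b).
-- Going backwards along a cycle of g, this makes every point on it divisible by 2^r; then for c on
-- the cycle, 2^(r+1) ∤ g(c), because 2^(r+1) divides 2c but not N. Conversely, g maps the odd
-- multiples of 2^r in [1, m] injectively into themselves, hence permutes them, so each lies on a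
-- cycle. Finally, the elements of fixed sets of f are exactly the points on cycles of f.
module Submission where

open import Defs
open import Data.Nat
  using (ℕ; zero; suc; _+_; _*_; _∸_; _^_; _≤_; _<_; _⊔_; _⊓_; ∣_-_∣; z≤n; s≤s; s≤s⁻¹; z<s; _≤?_; _≟_; NonZero)
open import Data.Nat.Properties
open import Data.Nat.DivMod
  using (_%_; _/_; m<n⇒m%n≡m; [m+kn]%n≡m%n; %-distribˡ-+; +-distrib-/-∣ʳ; m*n/n≡m; m<n⇒m/n≡0; m%n<n)
open import Data.Nat.Divisibility
  using ( _∣_; _∤_; divides; _∣0; 1∣_; n∣m*n; ∣n⇒∣m*n; ∣m+n∣m⇒∣n; ∣m∣n⇒∣m+n; *-monoʳ-∣; *-monoˡ-∣
        ; m*n∣⇒n∣; m%n≡0⇒n∣m)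
open import Data.Nat.Solver using (module +-*-Solver)
open import Data.Fin using (Fin; toℕ; fromℕ<)
open import Data.Fin.Properties using (pigeonhole; toℕ-fromℕ<)
open import Data.Product using (Σ; ∃; _×_; _,_; proj₁; proj₂; uncurry)
open import Data.Sum using (_⊎_; inj₁; inj₂)
open import Function.Bundles using (_⇔_; mk⇔; module Equivalence)
open import Relation.Nullary using (¬_; yes; no; contradiction)
open import Relation.Nullary.Decidable using (_×-dec_)
open import Relation.Unary using (Decidable)
open import Relation.Binary.PropositionalEquality
  using (_≡_; _≢_; refl; sym; trans; cong; cong₂; subst; subst₂; module ≡-Reasoning)

open +-*-Solver using (solve; _:=_; _:+_; _:*_; con)
open ≡-Reasoning

_^[_]_ : (ℕ → ℕ) → ℕ → ℕ → ℕ
h ^[ zero  ] x = x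
h ^[ suc t ] x = h (h ^[ t ] x)

^[]-+ : ∀ h s t x → h ^[ s + t ] x ≡ h ^[ s ] (h ^[ t ] x)
^[]-+ h zero    t x = refl
^[]-+ h (suc s) t x = cong h (^[]-+ h s t x)

^[]-comm : ∀ h s t x → h ^[ s ] (h ^[ t ] x) ≡ h ^[ t ] (h ^[ s ] x)
^[]-comm h s t x = begin
  h ^[ s ] (h ^[ t ] x)  ≡⟨ ^[]-+ h s t x ⟨
  h ^[ s + t ] x         ≡⟨ cong (λ k → h ^[ k ] x) (+-comm s t) ⟩
  h ^[ t + s ] x         ≡⟨ ^[]-+ h t s x ⟩
  h ^[ t ] (h ^[ s ] x)  ∎

^[]-periodic : ∀ h {t x} i → h ^[ t ] x ≡ x → h ^[ t ] (h ^[ i ] x) ≡ h ^[ i ] x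
^[]-periodic h {t} {x} i period = trans (^[]-comm h t i x) (cong (h ^[ i ]_) period)

^[]-eventually-periodic : ∀ h s t i x → h ^[ s + t ] x ≡ h ^[ s ] x
                        → h ^[ t ] (h ^[ s + i ] x) ≡ h ^[ s + i ] x
^[]-eventually-periodic h s t i x recur =
  subst (λ y → h ^[ t ] y ≡ y) (sym (shift i)) (^[]-periodic h {t} i (trans (sym (shift t)) recur))
  where
  shift : ∀ k → h ^[ s + k ] x ≡ h ^[ k ] (h ^[ s ] x)
  shift k = trans (cong (λ j → h ^[ j ] x) (+-comm s k)) (^[]-+ h k s x)

module _ {h : ℕ → ℕ} {A : ℕ → Set} (h-pres : ∀ {b} → A b → A (h b)) where

  ^[]-pres : ∀ t {b} → A b → A (h ^[ t ] b)
  ^[]-pres zero    Ab = Ab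
  ^[]-pres (suc t) Ab = h-pres (^[]-pres t Ab)

  module _ (h-injective : ∀ {b c} → A b → A c → h b ≡ h c → b ≡ c) where

    ^[]-injective : ∀ t {b c} → A b → A c → h ^[ t ] b ≡ h ^[ t ] c → b ≡ c
    ^[]-injective zero    Ab Ac eq = eq
    ^[]-injective (suc t) Ab Ac eq =
      ^[]-injective t Ab Ac (h-injective (^[]-pres t Ab) (^[]-pres t Ac) eq)

    -- Pigeonhole on the first B + 1 points of the orbit, then cancel the common prefix.
    injective⇒cycle : ∀ {B} → (∀ {b} → A b → b < B) → ∀ {a} → A a → ∃ λ t → h ^[ suc t ] a ≡ a
    injective⇒cycle {B} bounded {a} Aa with pigeonhole (n<1+n B) index
      where
      index : Fin (suc B) → Fin B
      index i = fromℕ< (bounded (^[]-pres (toℕ i) Aa))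
    ... | i , j , i<j , same-index with o , i+1+o≡j ← m≤n⇒∃[o]m+o≡n i<j =
      o , ^[]-injective (toℕ i) (^[]-pres (suc o) Aa) Aa (begin
        h ^[ toℕ i ] (h ^[ suc o ] a)  ≡⟨ ^[]-+ h (toℕ i) (suc o) a ⟨
        h ^[ toℕ i + suc o ] a         ≡⟨ cong (λ k → h ^[ k ] a) (trans (+-suc (toℕ i) o) i+1+o≡j) ⟩
        h ^[ toℕ j ] a                 ≡⟨ same-point ⟨
        h ^[ toℕ i ] a                 ∎)
      where
      same-point : h ^[ toℕ i ] a ≡ h ^[ toℕ j ] a
      same-point = trans (sym (toℕ-fromℕ< _)) (trans (cong toℕ same-index) (toℕ-fromℕ< _))

least-witness : ∀ {P : ℕ → Set} → Decidable P → ∀ v → (∃ λ j → j < v × P j)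
              → ∃ λ t → P t × (∀ j → j < t → ¬ P j)
least-witness P? zero    (_ , () , _)
least-witness P? (suc v) w with anyUpTo? P? v | w
... | yes earlier | _ = least-witness P? v earlier
... | no none | j , j<1+v , Pj with m<1+n⇒m<n∨m≡n j<1+v
...   | inj₁ j<v  = contradiction (j , j<v , Pj) none
...   | inj₂ refl = j , Pj , λ i i<j Pi → none (i , i<j , Pi)

OddMultiple : ℕ → ℕ → Set
OddMultiple d b = d ∣ b × 2 * d ∤ b

oddMultiple⇒≢0 : ∀ {d b} → OddMultiple d b → b ≢ 0
oddMultiple⇒≢0 (_ , 2d∤b) refl = 2d∤b (_ ∣0)

odd⇒%2≡1 : ∀ p → 2 ∤ p → p % 2 ≡ 1
odd⇒%2≡1 p 2∤p with p % 2 | m%n<n p 2 | m%n≡0⇒n∣m p 2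
... | 0           | _                | 2∣p = contradiction (2∣p refl) 2∤p
... | 1           | _                | _   = refl
... | suc (suc _) | s≤s (s≤s ())     | _

oddMultiple-+ : ∀ {d b c} → OddMultiple d b → OddMultiple d c → 2 * d ∣ b + c
oddMultiple-+ {d} (divides p refl , 2d∤b) (divides q refl , 2d∤c) =
  subst (2 * d ∣_) (*-distribʳ-+ d p q) (*-monoˡ-∣ d 2∣p+q)
  where
  odd : ∀ {p} → 2 * d ∤ p * d → p % 2 ≡ 1
  odd {p} 2d∤pd = odd⇒%2≡1 p (λ 2∣p → 2d∤pd (*-monoˡ-∣ d 2∣p))
  2∣p+q : 2 ∣ p + q
  2∣p+q = m%n≡0⇒n∣m (p + q) 2 (begin
    (p + q) % 2            ≡⟨ %-distribˡ-+ p q 2 ⟩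
    (p % 2 + q % 2) % 2    ≡⟨ cong₂ (λ x y → (x + y) % 2) (odd {p} 2d∤b) (odd {q} 2d∤c) ⟩
    0                      ∎)

kaprekar-difference-ordered : ∀ n {u v} → u ≤ v → (suc n * v + u) ∸ (suc n * u + v) ≡ n * ∣ u - v ∣
kaprekar-difference-ordered n {u} u≤v with w , refl ← m≤n⇒∃[o]m+o≡n u≤v rewrite ∣m-m+n∣≡n u w =
  trans (cong (_∸ (suc n * u + (u + w))) rearrange) (m+n∸n≡m (n * w) (suc n * u + (u + w)))
  where
  rearrange : suc n * (u + w) + u ≡ n * w + (suc n * u + (u + w))
  rearrange = solve 3 (λ n u w → (con 1 :+ n) :* (u :+ w) :+ u
                               := n :* w :+ ((con 1 :+ n) :* u :+ (u :+ w))) refl n u w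

kaprekar-difference : ∀ n u v
                    → (suc n * (u ⊔ v) + (u ⊓ v)) ∸ (suc n * (u ⊓ v) + (u ⊔ v)) ≡ n * ∣ u - v ∣
kaprekar-difference n u v with ≤-total u v
... | inj₁ u≤v rewrite m≤n⇒m⊔n≡n u≤v | m≤n⇒m⊓n≡m u≤v = kaprekar-difference-ordered n u≤v
... | inj₂ v≤u rewrite m≥n⇒m⊔n≡m v≤u | m≥n⇒m⊓n≡n v≤u | ∣-∣-comm u v =
  kaprekar-difference-ordered n v≤u

module _ {m} .{{_ : NonZero m}} {q} (p : ℕ) (q<m : q < m) where

  %-digit : (q + p * m) % m ≡ q
  %-digit = trans ([m+kn]%n≡m%n q p m) (m<n⇒m%n≡m q<m)

  /-digit : (q + p * m) / m ≡ p
  /-digit = begin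
    (q + p * m) / m    ≡⟨ +-distrib-/-∣ʳ q (n∣m*n p) ⟩
    q / m + p * m / m  ≡⟨ cong₂ _+_ (m<n⇒m/n≡0 q<m) (m*n/n≡m p m) ⟩
    p                  ∎

module Multiplier (N : ℕ) where

  -- g 0 = 0 (rather than N) because f 0 = 0.
  g : ℕ → ℕ
  g zero    = zero
  g (suc p) = ∣ N - 2 * suc p ∣

  OnCycle : ℕ → Set
  OnCycle b = ∃ λ t → g ^[ suc t ] b ≡ b

  g-branches : ∀ {b} → b ≢ 0 → g b + 2 * b ≡ N ⊎ g b + N ≡ 2 * b
  g-branches {zero}  b≢0 = contradiction refl b≢0
  g-branches {suc p} _ with ≤-total (2 * suc p) N
  ... | inj₁ 2b≤N = inj₁ (trans (cong (_+ 2 * suc p) (m≤n⇒∣n-m∣≡n∸m 2b≤N)) (m∸n+n≡m 2b≤N))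
  ... | inj₂ N≤2b = inj₂ (trans (cong (_+ N) (m≤n⇒∣m-n∣≡n∸m N≤2b)) (m∸n+n≡m N≤2b))

  g-< : ∀ {b} → b < N → g b < N
  g-< {zero}  0<N = 0<N
  g-< {suc p} b<N with g-branches {suc p} (λ ())
  ... | inj₁ g+2b≡N = subst (g (suc p) <_) g+2b≡N (m<m+n (g (suc p)) z<s)
  ... | inj₂ g+N≡2b = +-cancelʳ-< N (g (suc p)) N (subst (_< N + N) (sym g+N≡2b) 2b<N+N)
    where
    2b<N+N : 2 * suc p < N + N
    2b<N+N = subst (2 * suc p <_) (cong (N +_) (+-identityʳ N)) (*-monoʳ-< 2 b<N)

  ∣-g : ∀ {d} b → d ∣ 2 * b → d ∣ N → d ∣ g b
  ∣-g zero    _    _   = _ ∣0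
  ∣-g {d} (suc p) d∣2b d∣N with g-branches {suc p} (λ ())
  ... | inj₁ g+2b≡N = ∣m+n∣m⇒∣n (subst (d ∣_) (trans (sym g+2b≡N) (+-comm (g (suc p)) _)) d∣N) d∣2b
  ... | inj₂ g+N≡2b = ∣m+n∣m⇒∣n (subst (d ∣_) (trans (sym g+N≡2b) (+-comm (g (suc p)) N)) d∣2b) d∣N

  ∤-g : ∀ {d} b → b ≢ 0 → d ∣ 2 * b → d ∤ N → d ∤ g b
  ∤-g {d} b b≢0 d∣2b d∤N d∣g with g-branches b≢0
  ... | inj₁ g+2b≡N = d∤N (subst (d ∣_) g+2b≡N (∣m∣n⇒∣m+n d∣g d∣2b))
  ... | inj₂ g+N≡2b = d∤N (∣m+n∣m⇒∣n (subst (d ∣_) (sym g+N≡2b) d∣2b) d∣g)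

  onCycle-predecessor : ∀ {b} → OnCycle b → ∃ λ c → OnCycle c × g c ≡ b
  onCycle-predecessor {b} (t , cycle) = g ^[ t ] b , (t , ^[]-periodic g {suc t} t cycle) , cycle

  onCycle-∣ : ∀ j {b} → 2 ^ j ∣ N → OnCycle b → 2 ^ j ∣ b
  onCycle-∣ zero    _      _     = 1∣ _
  onCycle-∣ (suc j) 2^1+j∣N cycle with onCycle-predecessor cycle
  ... | c , c-cycle , refl =
    ∣-g c (*-monoʳ-∣ 2 (onCycle-∣ j (m*n∣⇒n∣ 2 (2 ^ j) 2^1+j∣N) c-cycle)) 2^1+j∣N

  branches-meet : ∀ {x b c} → x + 2 * b ≡ N → x + N ≡ 2 * c → b + c ≡ N
  branches-meet {x} {b} {c} x+2b≡N x+N≡2c = *-cancelˡ-≡ (b + c) N 2 (begin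
    2 * (b + c)       ≡⟨ *-distribˡ-+ 2 b c ⟩
    2 * b + 2 * c     ≡⟨ cong (2 * b +_) x+N≡2c ⟨
    2 * b + (x + N)   ≡⟨ solve 3 (λ b x N → con 2 :* b :+ (x :+ N) := (x :+ con 2 :* b) :+ N) refl b x N ⟩
    (x + 2 * b) + N   ≡⟨ cong (_+ N) x+2b≡N ⟩
    N + N             ≡⟨ cong (N +_) (+-identityʳ N) ⟨
    2 * N             ∎)

  module _ (r : ℕ) (N-odd : OddMultiple (2 ^ r) N) where

    onCycle⇒oddMultiple : ∀ {a} → a ≢ 0 → OnCycle a → OddMultiple (2 ^ r) a
    onCycle⇒oddMultiple a≢0 cycle with onCycle-predecessor cycle
    ... | c , c-cycle , refl =
      onCycle-∣ r (proj₁ N-odd) cycle ,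
      ∤-g c c≢0 (*-monoʳ-∣ 2 (onCycle-∣ r (proj₁ N-odd) c-cycle)) (proj₂ N-odd)
      where
      c≢0 : c ≢ 0
      c≢0 refl = a≢0 refl

    g-oddMultiple : ∀ {b} → OddMultiple (2 ^ r) b → OddMultiple (2 ^ r) (g b)
    g-oddMultiple {b} b-odd@(d∣b , _) =
      ∣-g b (∣n⇒∣m*n 2 d∣b) (proj₁ N-odd) ,
      ∤-g b (oddMultiple⇒≢0 b-odd) (*-monoʳ-∣ 2 d∣b) (proj₂ N-odd)

    -- Preimages from opposite branches would sum to N, an odd multiple of 2 ^ r,
    -- whereas two odd multiples of 2 ^ r sum to a multiple of 2 ^ (1 + r).
    g-injective : ∀ {b c} → OddMultiple (2 ^ r) b → OddMultiple (2 ^ r) c → g b ≡ g c → b ≡ c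
    g-injective {b} {c} b-odd c-odd gb≡gc
      with g-branches (oddMultiple⇒≢0 b-odd) | g-branches (oddMultiple⇒≢0 c-odd)
    ... | inj₁ gb+2b≡N | inj₁ gc+2c≡N =
      *-cancelˡ-≡ b c 2 (+-cancelˡ-≡ (g b) _ _
        (trans gb+2b≡N (trans (sym gc+2c≡N) (cong (_+ 2 * c) (sym gb≡gc)))))
    ... | inj₂ gb+N≡2b | inj₂ gc+N≡2c =
      *-cancelˡ-≡ b c 2 (trans (sym gb+N≡2b) (trans (cong (_+ N) gb≡gc) gc+N≡2c))
    ... | inj₁ gb+2b≡N | inj₂ gc+N≡2c = contradiction
      (subst (_ ∣_) (branches-meet {b = b} {c} gb+2b≡N (trans (cong (_+ N) gb≡gc) gc+N≡2c))
        (oddMultiple-+ b-odd c-odd))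
      (proj₂ N-odd)
    ... | inj₂ gb+N≡2b | inj₁ gc+2c≡N = contradiction
      (subst (_ ∣_) (branches-meet {b = c} {b} gc+2c≡N (trans (cong (_+ N) (sym gb≡gc)) gb+N≡2b))
        (oddMultiple-+ c-odd b-odd))
      (proj₂ N-odd)

    oddMultiple⇒onCycle : ∀ {a} → a < N → OddMultiple (2 ^ r) a → OnCycle a
    oddMultiple⇒onCycle a<N a-odd =
      injective⇒cycle {A = λ b → b < N × OddMultiple (2 ^ r) b}
        (λ (b<N , b-odd) → g-< b<N , g-oddMultiple b-odd)
        (λ (_ , b-odd) (_ , c-odd) → g-injective b-odd c-odd)
        proj₁ (a<N , a-odd)

module FixedSets (m : ℕ) .{{_ : NonZero m}} where
  open Kaprekar m

  iter≡f^[] : ∀ t x → iter t x ≡ f ^[ t ] x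
  iter≡f^[] zero    x = refl
  iter≡f^[] (suc t) x = cong f (iter≡f^[] t x)

  inK⇒cycle : ∀ {x y} → InK x y → ∃ λ t → f ^[ suc t ] y ≡ y
  inK⇒cycle {x} (s , suc t , _ , (_ , recur , _) , i , _ , refl) =
    t , subst₂ (λ u v → f ^[ suc t ] u ≡ v) (sym (iter≡f^[] (s + i) x)) (sym (iter≡f^[] (s + i) x))
          (^[]-eventually-periodic f s (suc t) i x
            (trans (sym (iter≡f^[] (s + suc t) x)) (trans recur (iter≡f^[] s x))))

  cycle⇒inK : ∀ {x} t → f ^[ suc t ] x ≡ x → InK x x
  cycle⇒inK {x} t cycle
    with least-witness returns? (2 + t) (suc t , ≤-refl , s≤s z≤n , trans (iter≡f^[] (suc t) x) cycle)
    where
    Returns : ℕ → Set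
    Returns k = 1 ≤ k × iter k x ≡ x
    returns? : Decidable Returns
    returns? k = (1 ≤? k) ×-dec (iter k x ≟ x)
  ... | T , (1≤T , returns) , earliest =
    0 , T , ((T , 1≤T , returns) , λ _ ()) ,
    (1≤T , returns , λ k 1≤k k<T returns-k → earliest k k<T (1≤k , returns-k)) ,
    0 , 1≤T , refl

g-digits : ∀ p q → ∣ suc (suc (p + q)) - 2 * suc p ∣ ≡ ∣ q - p ∣
g-digits p q = begin
  ∣ suc (p + q) - p + suc (p + 0) ∣
    ≡⟨ cong₂ (λ u v → ∣ u - p + suc v ∣) (sym (+-suc p q)) (+-identityʳ p) ⟩
  ∣ p + suc q - p + suc p ∣          ≡⟨ ∣m+n-m+o∣≡∣n-o∣ p (suc q) (suc p) ⟩
  ∣ q - p ∣                          ∎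

module Multiples (n : ℕ) where
  open Kaprekar (suc n)
  open Multiplier (suc (suc n))

  f-digits : ∀ x → f x ≡ n * ∣ d₀ x - d₁ x ∣
  f-digits x = kaprekar-difference n (d₀ x) (d₁ x)

  f-multiple : ∀ {b} → b ≤ suc n → f (b * n) ≡ g b * n
  f-multiple {zero}  _         = trans (f-digits 0) (*-zeroʳ n)
  f-multiple {suc p} (s≤s p≤n) with q , refl ← m≤n⇒∃[o]m+o≡n p≤n = begin
    f (suc p * (p + q))                         ≡⟨ f-digits x ⟩
    (p + q) * ∣ x % suc (p + q) - x / suc (p + q) ∣
      ≡⟨ cong (λ y → (p + q) * ∣ y % suc (p + q) - y / suc (p + q) ∣) digits ⟩
    (p + q) * ∣ q' % suc (p + q) - q' / suc (p + q) ∣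
      ≡⟨ cong₂ (λ u v → (p + q) * ∣ u - v ∣) (%-digit p q<m) (/-digit p q<m) ⟩
    (p + q) * ∣ q - p ∣                         ≡⟨ *-comm (p + q) _ ⟩
    ∣ q - p ∣ * (p + q)                         ≡⟨ cong (_* (p + q)) (g-digits p q) ⟨
    g (suc p) * (p + q)                         ∎
    where
    x  = suc p * (p + q)
    q' = q + p * suc (p + q)
    digits : x ≡ q'
    digits = solve 2 (λ p q → (con 1 :+ p) :* (p :+ q) := q :+ p :* (con 1 :+ (p :+ q))) refl p q
    q<m : q < suc (p + q)
    q<m = s≤s (m≤n+m q p)

  f^[]-multiple : ∀ t {b} → b ≤ suc n → f ^[ t ] (b * n) ≡ g ^[ t ] b * n
  f^[]-multiple zero    _   = refl
  f^[]-multiple (suc t) b≤m = trans (cong f (f^[]-multiple t b≤m))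
    (f-multiple (s≤s⁻¹ (^[]-pres {A = _< suc (suc n)} g-< t (s≤s b≤m))))

  f-cycle⇔g-cycle : .{{_ : NonZero n}} → ∀ {b} → b ≤ suc n
                  → (∃ λ t → f ^[ suc t ] (b * n) ≡ b * n) ⇔ OnCycle b
  f-cycle⇔g-cycle b≤m = mk⇔
    (λ (t , cycle) → t , *-cancelʳ-≡ _ _ n (trans (sym (f^[]-multiple (suc t) b≤m)) cycle))
    (λ (t , cycle) → t , trans (f^[]-multiple (suc t) b≤m) (cong (_* n) cycle))

exact⇔oddMultiple : ∀ r b → ((2 ^ r ∣ b) × ¬ (2 ^ (r + 1) ∣ b)) ⇔ OddMultiple (2 ^ r) b
exact⇔oddMultiple r b = mk⇔
  (λ (2^r∣b , 2^[r+1]∤b) → 2^r∣b , λ 2*2^r∣b → 2^[r+1]∤b (subst (_∣ b) (sym 2^[r+1]≡2*2^r) 2*2^r∣b))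
  (λ (2^r∣b , 2*2^r∤b) → 2^r∣b , λ 2^[r+1]∣b → 2*2^r∤b (subst (_∣ b) 2^[r+1]≡2*2^r 2^[r+1]∣b))
  where
  2^[r+1]≡2*2^r : 2 ^ (r + 1) ≡ 2 * 2 ^ r
  2^[r+1]≡2*2^r = cong (2 ^_) (+-comm r 1)

lemma3p4p1 : (m : ℕ) → 2 ≤ m → .{{_ : NonZero m}} → (r : ℕ)
    → 2 ^ r ∣ m + 1 → ¬ (2 ^ (r + 1) ∣ m + 1)
    → (a : ℕ) → 1 ≤ a → a ≤ m
    → (Σ ℕ λ x → Kaprekar.InX m x × Kaprekar.NonTrivialK m x × Kaprekar.InK m x (a * (m ∸ 1)))
    ⇔ ((2 ^ r ∣ a) × ¬ (2 ^ (r + 1) ∣ a))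
lemma3p4p1 (suc zero) (s≤s ()) _ _ _ _ _ _
lemma3p4p1 (suc n@(suc _)) _ r 2^r∣m+1 2^[r+1]∤m+1 a 1≤a a≤m = mk⇔
  (λ (_ , _ , _ , a*n∈K) → from (exact⇔oddMultiple r a) (onCycle⇒oddMultiple r N-odd a≢0 (a-onCycle a*n∈K)))
  (λ a-exact → a * n , a*n∈X , (a * n , a*n∈K a-exact , a*n≢0) , a*n∈K a-exact)
  where
  open Equivalence
  open Kaprekar (suc n)
  open FixedSets (suc n)
  open Multiplier (suc (suc n))
  open Multiples n

  N-odd : OddMultiple (2 ^ r) (suc (suc n))
  N-odd = subst (OddMultiple (2 ^ r)) (+-comm (suc n) 1) (to (exact⇔oddMultiple r _) (2^r∣m+1 , 2^[r+1]∤m+1))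

  a≢0 : a ≢ 0
  a≢0 = n>0⇒n≢0 1≤a

  a-onCycle : ∀ {x} → InK x (a * n) → OnCycle a
  a-onCycle a*n∈K = to (f-cycle⇔g-cycle a≤m) (inK⇒cycle a*n∈K)

  a*n∈K : (2 ^ r ∣ a) × ¬ (2 ^ (r + 1) ∣ a) → InK (a * n) (a * n)
  a*n∈K a-exact = uncurry cycle⇒inK
    (from (f-cycle⇔g-cycle a≤m) (oddMultiple⇒onCycle r N-odd (s≤s a≤m) (to (exact⇔oddMultiple r a) a-exact)))

  a*n∈X : InX (a * n)
  a*n∈X = ≤-<-trans (*-monoˡ-≤ n a≤m) (*-monoʳ-< (suc n) (n<1+n n))

  a*n≢0 : a * n ≢ 0
  a*n≢0 a*n≡0 = a≢0 (*-cancelʳ-≡ a 0 n a*n≡0)
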